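{- Let $i,j,z$ be integers with $i,j\ge 1$ and $i+j-1\le z$. Then, with Boolean matrix multiplication, $$C_{i,z-i}\cdot C_{j,z-j} = C_{i+j-1,\,z-i-j+1}.$$
   Context: For integers $p\ge 1$, $q\ge 0$ and $n=p+q$, $C_{p,q}$ is the $n\times n$ circulant $0,1$-matrix whose entry in row $i$, column $j$ ($1\le i,j\le n$) is $1$ iff $(i-j) \bmod n \in\{0,1,\dots,p-1\}$ (its first column is $p$ ones followed by $q$ zeros). Boolean multiplication uses $1+1=1$, $1+0=0+1=1$, $0+0=0$ and ordinary multiplication of $0,1$. -}

module Defs where

open import Data.Nat using (ℕ; _+_; _∸_; _<ᵇ_; _%_; suc)
open import Data.Fin using (Fin; toℕ; cast)
open import Data.Bool using (Bool; true; false; _∧_; _∨_)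
open import Relation.Binary.PropositionalEquality using (_≡_; sym)

-- Square Boolean matrices of size n, indices 0..n-1 (paper's rows/cols 1..n shifted by one).
Mat : ℕ → Set
Mat n = Fin n → Fin n → Bool

⋁ : ∀ {n} → (Fin n → Bool) → Bool
⋁ {ℕ.zero}  f = false
⋁ {suc n}   f = f Fin.zero ∨ ⋁ (λ k → f (Fin.suc k))

_⊙_ : ∀ {n} → Mat n → Mat n → Mat n
(A ⊙ B) r c = ⋁ (λ k → A r k ∧ B k c)

diffMod : ∀ {n} → Fin n → Fin n → ℕ
diffMod {n} r c = ((n + toℕ r) ∸ toℕ c) % suc (n ∸ 1)
-- note: for n ≥ 1 (the only case with any indices), suc (n ∸ 1) = n.

C : (p q : ℕ) → Mat (p + q)
C p q r c = diffMod r c <ᵇ p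

castMat : ∀ {n m} → n ≡ m → Mat n → Mat m
castMat eq A r c = A (cast (sym eq) r) (cast (sym eq) c)

open import Data.Nat using (_≤_; s≤s; z≤n)
open import Data.Nat.Properties using (≤-trans; m≤m+n; m+n∸n≡m)

left≤ : ∀ {i j z} → 1 ≤ j → i + j ∸ 1 ≤ z → i ≤ z
left≤ {i} {suc j} (s≤s z≤n) h rewrite Data.Nat.Properties.+-suc i j = ≤-trans (m≤m+n i j) h

right≤ : ∀ {i j z} → 1 ≤ i → i + j ∸ 1 ≤ z → j ≤ z
right≤ {suc i} {j} (s≤s z≤n) h = ≤-trans (Data.Nat.Properties.m≤n+m j i) h

module Submission where

-- Index rows and columns by 0,…,N-1 and write
-- dist N x y = (x - y) mod N for the cyclic distance from y forward to x.
-- Then C_{p,q} has entry (r,c) equal to 1 iff dist r c < p, and the Boolean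
-- product entry (r,c) says: some k lies within distance i-1 of r and c lies
-- within distance j-1 of k.  Two facts about the cyclic distance settle this:
--   * triangle inequality  dist x y ≤ dist x k + dist k y,  since the right
--     side reduces to the left one modulo N;
--   * exact splitting: whenever u + v = dist x y there is a k with
--     dist x k = u and dist k y = v (namely k = (y + v) mod N).
-- Hence "∃ k, dist r k ≤ i-1 ∧ dist k c ≤ j-1" holds iff dist r c ≤ i+j-2,
-- which is the (r,c) entry of C_{i+j-1, z-i-j+1}.
-- Both distance facts follow from a uniqueness property: dist x y is the only
-- w < N with w + y ≡ x (mod N).

open import Defs
open import Data.Nat using (ℕ; zero; suc; _+_; _∸_; _≤_; _<_; _<ᵇ_; _%_; _⊓_; s≤s; s≤s⁻¹; NonZero)
open import Data.Nat.Properties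
  using (+-comm; +-assoc; +-suc; ≤-<-trans; <⇒≤; m≤n+m; +-∸-assoc; m+[n∸m]≡n; m∸n+n≡m;
         m≤m+n; m≤n+o⇒m∸n≤o; m⊓n≤m; m⊓n+n∸m≡n; +-mono-≤; <ᵇ⇒<; <⇒<ᵇ; ≤-trans)
open import Data.Nat.DivMod
  using (%-distribˡ-+; m%n%n≡m%n; [m+n]%n≡m%n; m<n⇒m%n≡m; m%n<n; m%n≤n; m%n≤m)
open import Data.Fin using (Fin; toℕ; fromℕ<)
open import Data.Fin.Properties using (toℕ-cast; toℕ-fromℕ<; toℕ<n)
open import Data.Bool using (Bool; true; T; _∧_; _∨_)
open import Data.Bool.Properties using (T-≡; T-∧; T-∨; ⇔→≡)
open import Data.Product using (_×_; _,_; ∃-syntax; proj₁; proj₂)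
open import Data.Sum using (inj₁; inj₂)
open import Function using (_∘_)
open import Function.Bundles using (_⇔_; mk⇔; Equivalence)
open import Relation.Binary.PropositionalEquality
  using (_≡_; refl; sym; cong; cong₂; subst; module ≡-Reasoning)

open ≡-Reasoning

[m%n+k]%n≡[m+k]%n : ∀ m k N .{{_ : NonZero N}} → (m % N + k) % N ≡ (m + k) % N
[m%n+k]%n≡[m+k]%n m k N = begin
  (m % N + k) % N          ≡⟨ %-distribˡ-+ (m % N) k N ⟩
  (m % N % N + k % N) % N  ≡⟨ cong (λ t → (t + k % N) % N) (m%n%n≡m%n m N) ⟩
  (m % N + k % N) % N      ≡⟨ %-distribˡ-+ m k N ⟨
  (m + k) % N              ∎

[m+k%n]%n≡[m+k]%n : ∀ m k N .{{_ : NonZero N}} → (m + k % N) % N ≡ (m + k) % N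
[m+k%n]%n≡[m+k]%n m k N = begin
  (m + k % N) % N  ≡⟨ cong (_% N) (+-comm m (k % N)) ⟩
  (k % N + m) % N  ≡⟨ [m%n+k]%n≡[m+k]%n k m N ⟩
  (k + m) % N      ≡⟨ cong (_% N) (+-comm k m) ⟩
  (m + k) % N      ∎

-- Cyclic distance from y forward to x modulo N; on Fin (suc n) this is
-- exactly Defs.diffMod.
dist : (N : ℕ) .{{_ : NonZero N}} → ℕ → ℕ → ℕ
dist N x y = (N + x ∸ y) % N

dist<N : ∀ N .{{_ : NonZero N}} x y → dist N x y < N
dist<N N x y = m%n<n (N + x ∸ y) N

dist-+ : ∀ N .{{_ : NonZero N}} x {y} → y ≤ N → (dist N x y + y) % N ≡ x % N
dist-+ N x {y} y≤N = begin
  ((N + x ∸ y) % N + y) % N  ≡⟨ [m%n+k]%n≡[m+k]%n (N + x ∸ y) y N ⟩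
  (N + x ∸ y + y) % N        ≡⟨ cong (_% N) (m∸n+n≡m (≤-trans y≤N (m≤m+n N x))) ⟩
  (N + x) % N                ≡⟨ cong (_% N) (+-comm N x) ⟩
  (x + N) % N                ≡⟨ [m+n]%n≡m%n x N ⟩
  x % N                      ∎

dist-unique : ∀ N .{{_ : NonZero N}} {x y w} → w < N → y ≤ N →
              (w + y) % N ≡ x % N → dist N x y ≡ w
dist-unique N {x} {y} {w} w<N y≤N eq = begin
  (N + x ∸ y) % N          ≡⟨ cong (λ t → (t ∸ y) % N) (+-comm N x) ⟩
  (x + N ∸ y) % N          ≡⟨ cong (_% N) (+-∸-assoc x y≤N) ⟩
  (x + (N ∸ y)) % N        ≡⟨ [m%n+k]%n≡[m+k]%n x (N ∸ y) N ⟨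
  (x % N + (N ∸ y)) % N    ≡⟨ cong (λ t → (t + (N ∸ y)) % N) eq ⟨
  ((w + y) % N + (N ∸ y)) % N ≡⟨ [m%n+k]%n≡[m+k]%n (w + y) (N ∸ y) N ⟩
  (w + y + (N ∸ y)) % N    ≡⟨ cong (_% N) (+-assoc w y (N ∸ y)) ⟩
  (w + (y + (N ∸ y))) % N  ≡⟨ cong (λ t → (w + t) % N) (m+[n∸m]≡n y≤N) ⟩
  (w + N) % N              ≡⟨ [m+n]%n≡m%n w N ⟩
  w % N                    ≡⟨ m<n⇒m%n≡m w<N ⟩
  w                        ∎

dist-additive : ∀ N .{{_ : NonZero N}} x {k y} → k ≤ N → y ≤ N →
                dist N x y ≡ (dist N x k + dist N k y) % N
dist-additive N x {k} {y} k≤N y≤N =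
  dist-unique N (m%n<n (dxk + dky) N) y≤N (begin
    ((dxk + dky) % N + y) % N  ≡⟨ [m%n+k]%n≡[m+k]%n (dxk + dky) y N ⟩
    (dxk + dky + y) % N        ≡⟨ cong (_% N) (+-assoc dxk dky y) ⟩
    (dxk + (dky + y)) % N      ≡⟨ [m+k%n]%n≡[m+k]%n dxk (dky + y) N ⟨
    (dxk + (dky + y) % N) % N  ≡⟨ cong (λ t → (dxk + t) % N) (dist-+ N k y≤N) ⟩
    (dxk + k % N) % N          ≡⟨ [m+k%n]%n≡[m+k]%n dxk k N ⟩
    (dxk + k) % N              ≡⟨ dist-+ N x k≤N ⟩
    x % N                      ∎)
  where
  dxk = dist N x k
  dky = dist N k y

dist-triangle : ∀ N .{{_ : NonZero N}} x {k y} → k ≤ N → y ≤ N →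
                dist N x y ≤ dist N x k + dist N k y
dist-triangle N x {k} {y} k≤N y≤N =
  subst (_≤ dist N x k + dist N k y) (sym (dist-additive N x k≤N y≤N))
        (m%n≤m (dist N x k + dist N k y) N)

dist-split : ∀ N .{{_ : NonZero N}} x {y u v} → y ≤ N → u + v ≡ dist N x y →
             dist N x ((y + v) % N) ≡ u × dist N ((y + v) % N) y ≡ v
dist-split N x {y} {u} {v} y≤N u+v≡d = dist-to-k , dist-from-k
  where
  u+v<N : u + v < N
  u+v<N = subst (_< N) (sym u+v≡d) (dist<N N x y)

  dist-to-k : dist N x ((y + v) % N) ≡ u
  dist-to-k = dist-unique N (≤-<-trans (m≤m+n u v) u+v<N) (m%n≤n (y + v) N) (begin
    (u + (y + v) % N) % N  ≡⟨ [m+k%n]%n≡[m+k]%n u (y + v) N ⟩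
    (u + (y + v)) % N      ≡⟨ cong (λ t → (u + t) % N) (+-comm y v) ⟩
    (u + (v + y)) % N      ≡⟨ cong (_% N) (+-assoc u v y) ⟨
    (u + v + y) % N        ≡⟨ cong (λ t → (t + y) % N) u+v≡d ⟩
    (dist N x y + y) % N   ≡⟨ dist-+ N x y≤N ⟩
    x % N                  ∎)
  
  dist-from-k : dist N ((y + v) % N) y ≡ v
  dist-from-k = dist-unique N (≤-<-trans (m≤n+m v u) u+v<N) y≤N (begin
    (v + y) % N          ≡⟨ cong (_% N) (+-comm v y) ⟩
    (y + v) % N          ≡⟨ m%n%n≡m%n (y + v) N ⟨
    (y + v) % N % N      ∎)

two-step-reach : ∀ n (a b : Fin (suc n)) u v →
  (∃[ k ] dist (suc n) (toℕ a) (toℕ k) ≤ u × dist (suc n) (toℕ k) (toℕ b) ≤ v)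
    ⇔ dist (suc n) (toℕ a) (toℕ b) ≤ u + v
two-step-reach n a b u v = mk⇔ via-triangle via-split
  where
  N : ℕ
  N = suc n
  b≤N : toℕ b ≤ N
  b≤N = <⇒≤ (toℕ<n b)
  d : ℕ
  d = dist N (toℕ a) (toℕ b)

  via-triangle : (∃[ k ] dist N (toℕ a) (toℕ k) ≤ u × dist N (toℕ k) (toℕ b) ≤ v) → d ≤ u + v
  via-triangle (k , ak≤u , kb≤v) =
    ≤-trans (dist-triangle N (toℕ a) (<⇒≤ (toℕ<n k)) b≤N) (+-mono-≤ ak≤u kb≤v)

  -- split d as (u ⊓ d) + (d ∸ u); the second part is at most v
  via-split : d ≤ u + v → ∃[ k ] dist N (toℕ a) (toℕ k) ≤ u × dist N (toℕ k) (toℕ b) ≤ v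
  via-split d≤u+v = k , ak≤u , kb≤v
    where
    k<N : (toℕ b + (d ∸ u)) % N < N
    k<N = m%n<n (toℕ b + (d ∸ u)) N
    k : Fin N
    k = fromℕ< k<N
    split : dist N (toℕ a) ((toℕ b + (d ∸ u)) % N) ≡ u ⊓ d
          × dist N ((toℕ b + (d ∸ u)) % N) (toℕ b) ≡ d ∸ u
    split = dist-split N (toℕ a) b≤N (m⊓n+n∸m≡n u d)
    ak≤u : dist N (toℕ a) (toℕ k) ≤ u
    ak≤u = subst (λ t → dist N (toℕ a) t ≤ u) (sym (toℕ-fromℕ< k<N))
                 (subst (_≤ u) (sym (proj₁ split)) (m⊓n≤m u d))
    kb≤v : dist N (toℕ k) (toℕ b) ≤ v
    kb≤v = subst (λ t → dist N t (toℕ b) ≤ v) (sym (toℕ-fromℕ< k<N))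
                 (subst (_≤ v) (sym (proj₂ split)) (m≤n+o⇒m∸n≤o d u d≤u+v))

T-ext : ∀ {x y} → (T x → T y) → (T y → T x) → x ≡ y
T-ext to from = ⇔→≡ (mk⇔ (T→≡ ∘ to ∘ ≡→T) (T→≡ ∘ from ∘ ≡→T))
  where
  T→≡ : ∀ {b} → T b → b ≡ true
  T→≡ = Equivalence.to T-≡
  ≡→T : ∀ {b} → b ≡ true → T b
  ≡→T = Equivalence.from T-≡

T-<ᵇ-suc : ∀ m u → T (m <ᵇ suc u) ⇔ m ≤ u
T-<ᵇ-suc m u = mk⇔ (s≤s⁻¹ ∘ <ᵇ⇒< m (suc u)) (<⇒<ᵇ ∘ s≤s)

⋁-intro : ∀ {n} (f : Fin n → Bool) k → T (f k) → T (⋁ f)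
⋁-intro f Fin.zero    t = Equivalence.from T-∨ (inj₁ t)
⋁-intro f (Fin.suc k) t = Equivalence.from T-∨ (inj₂ (⋁-intro (f ∘ Fin.suc) k t))

⋁-elim : ∀ {n} (f : Fin n → Bool) → T (⋁ f) → ∃[ k ] T (f k)
⋁-elim {suc n} f t with Equivalence.to T-∨ t
... | inj₁ t₀ = Fin.zero , t₀
... | inj₂ t₁ with ⋁-elim (f ∘ Fin.suc) t₁
...   | k , tk = Fin.suc k , tk

⋁-cong : ∀ {n} {f g : Fin n → Bool} → (∀ k → f k ≡ g k) → ⋁ f ≡ ⋁ g
⋁-cong {zero}  f≡g = refl
⋁-cong {suc n} f≡g = cong₂ _∨_ (f≡g Fin.zero) (⋁-cong (f≡g ∘ Fin.suc))

circulant-product-entry : ∀ n (a b : Fin (suc n)) u v →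
  ⋁ (λ (k : Fin (suc n)) → (dist (suc n) (toℕ a) (toℕ k) <ᵇ suc u) ∧ (dist (suc n) (toℕ k) (toℕ b) <ᵇ suc v))
    ≡ (dist (suc n) (toℕ a) (toℕ b) <ᵇ suc (u + v))
circulant-product-entry n a b u v = T-ext to from
  where
  δ : Fin (suc n) → Fin (suc n) → ℕ
  δ x y = dist (suc n) (toℕ x) (toℕ y)
  via : Fin (suc n) → Bool
  via k = (δ a k <ᵇ suc u) ∧ (δ k b <ᵇ suc v)
  reach : (∃[ k ] δ a k ≤ u × δ k b ≤ v) ⇔ δ a b ≤ u + v
  reach = two-step-reach n a b u v

  to : T (⋁ via) → T (δ a b <ᵇ suc (u + v))
  to t with ⋁-elim via t
  ... | k , tk with Equivalence.to T-∧ tk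
  ...   | ak , kb = Equivalence.from (T-<ᵇ-suc (δ a b) (u + v))
          (Equivalence.to reach (k , Equivalence.to (T-<ᵇ-suc _ u) ak , Equivalence.to (T-<ᵇ-suc _ v) kb))

  from : T (δ a b <ᵇ suc (u + v)) → T (⋁ via)
  from t with Equivalence.from reach (Equivalence.to (T-<ᵇ-suc (δ a b) (u + v)) t)
  ... | k , ak≤u , kb≤v = ⋁-intro via k (Equivalence.from T-∧
          (Equivalence.from (T-<ᵇ-suc _ u) ak≤u , Equivalence.from (T-<ᵇ-suc _ v) kb≤v))

castMat-C : ∀ p q {z} (eq : p + q ≡ z) (r c : Fin z) →
            castMat eq (C p q) r c ≡ (diffMod r c <ᵇ p)
castMat-C p q refl r c rewrite toℕ-cast refl r | toℕ-cast refl c = refl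

-- With i = suc u and j = suc v the band width i + j - 1 is suc (u + v); the
-- hypothesis h only serves to make the three matrices of size z well formed.
mainTheorem5 : (i j z : ℕ) → (1≤i : 1 ≤ i) → (1≤j : 1 ≤ j) → (h : i + j ∸ 1 ≤ z) →
    ∀ (r c : Fin z) →
      (castMat (m+[n∸m]≡n (left≤ {i} {j} 1≤j h)) (C i (z ∸ i))
        ⊙ castMat (m+[n∸m]≡n (right≤ {i} {j} 1≤i h)) (C j (z ∸ j))) r c
        ≡ castMat (m+[n∸m]≡n h) (C (i + j ∸ 1) (z ∸ (i + j ∸ 1))) r c
mainTheorem5 (suc u) (suc v) (suc n) 1≤i@(s≤s _) 1≤j@(s≤s _) h r c = begin
  ⋁ (λ (k : Fin (suc n)) → castMat eqᵢ (C (suc u) (suc n ∸ suc u)) r k ∧ castMat eqⱼ (C (suc v) (suc n ∸ suc v)) k c)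
    ≡⟨ ⋁-cong (λ k → cong₂ _∧_ (castMat-C (suc u) _ eqᵢ r k) (castMat-C (suc v) _ eqⱼ k c)) ⟩
  ⋁ (λ (k : Fin (suc n)) → (diffMod r k <ᵇ suc u) ∧ (diffMod k c <ᵇ suc v))
    ≡⟨ circulant-product-entry n r c u v ⟩
  (diffMod r c <ᵇ suc (u + v))
    ≡⟨ cong (diffMod r c <ᵇ_) (+-suc u v) ⟨
  (diffMod r c <ᵇ u + suc v)
    ≡⟨ castMat-C (u + suc v) _ (m+[n∸m]≡n h) r c ⟨
  castMat (m+[n∸m]≡n h) (C (u + suc v) (suc n ∸ (u + suc v))) r c ∎
  where
  eqᵢ = m+[n∸m]≡n (left≤ {suc u} {suc v} 1≤j h)
  eqⱼ = m+[n∸m]≡n (right≤ {suc u} {suc v} 1≤i h)
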